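{- Let $m\ge2$ and let $\lambda$ be a partition. For $i\in\{0,\dots,m-1\}$ let $N_i$ be the number of cells $(r,c)$ of $\lambda$ (row $r$, column $c$) with $c-r\equiv i \pmod m$. Then the $m$-shift of $\lambda$ is $(N_0-N_1, N_1-N_2, \dots, N_{m-2}-N_{m-1}, N_{m-1}-N_0)$.
   Context: Place the Young diagram of $\lambda$ so that cell $(r,c)$ is the unit square $[c-1,c]\times[-r,-r+1]$. The boundary of $\lambda$ is the doubly infinite lattice path coming up the negative $y$-axis, following the lower-right boundary of the diagram, then continuing east along the positive $x$-axis. For its lattice points $x+y$ takes each integer value exactly once; the edge sequence $M:\mathbb{Z}\to\{0,1\}$ has $M(t)=0$ if the step from the point with $x+y=t$ to the point with $x+y=t+1$ is north and $M(t)=1$ if it is east. A doubly infinite $0/1$ sequence that is $0$ far to the left and $1$ far to the right is the edge sequence of a (unique) partition iff the number of $1$'s at indices $<0$ equals the number of $0$'s at indices $\ge0$. For $i=0,\dots,m-1$ there is a unique integer $k_i$ such that $M_i(j)=M(m(j+k_i)+i)$ is an edge sequence; the partition $\lambda_i$ with edge sequence $M_i$ is the $i$-th component of the $m$-quotient $(\lambda_0,\dots,\lambda_{m-1})$, and $(k_0,\dots,k_{m-1})$ is the $m$-shift of $\lambda$. -}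

module Defs where

open import Data.Nat as ℕ using (ℕ; zero; suc; _<_; _≥_)
open import Data.Nat.Divisibility using (_∣?_)
open import Data.Integer as ℤ using (ℤ; +_; -[1+_]; _-_; ∣_∣)
open import Data.Bool using (Bool; true; false; not; _∨_)
open import Data.List using (List; []; _∷_; length; map; _++_; applyUpTo; filterᵇ)
open import Data.List.Relation.Unary.All using (All)
open import Data.List.Relation.Unary.Linked using (Linked)
open import Data.Product using (Σ; _×_; _,_)
open import Relation.Nullary.Decidable using (does)
open import Relation.Binary.PropositionalEquality using (_≡_)

IsPartition : List ℕ → Set
IsPartition λs = Linked _≥_ λs × All (0 <_) λs

-- Cells (r , c) of the Young diagram, 1-indexed: 1 ≤ r ≤ ℓ, 1 ≤ c ≤ λ_r.
cellsFrom : ℕ → List ℕ → List (ℕ × ℕ)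
cellsFrom r []       = []
cellsFrom r (a ∷ as) = map (λ c → (r , c)) (applyUpTo suc a) ++ cellsFrom (suc r) as

cells : List ℕ → List (ℕ × ℕ)
cells = cellsFrom 1

congMod : ℕ → ℕ → ℕ × ℕ → Bool
congMod m i (r , c) = does (m ∣? ∣ (+ c - + r) - + i ∣)

N : ℕ → List ℕ → ℕ → ℕ
N m λs i = length (filterᵇ (congMod m i) (cells λs))

-- Edge sequence of a partition (false = 0 = north step, true = 1 = east step).
-- The boundary path's north step in row r (r ≥ 1, with λ_r = 0 for r > ℓ)
-- runs from (λ_r , -r) to (λ_r , -r+1), so it starts at the point with
-- x + y = λ_r - r.  Hence M(t) = 0 iff t = λ_r - r for some r ≥ 1, i.e.
-- iff t ≤ -(ℓ+1) or t = λ_r - r for some 1 ≤ r ≤ ℓ; otherwise M(t) = 1.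
northIn : ℕ → List ℕ → ℤ → Bool
northIn r []       t = false
northIn r (a ∷ as) t = does (t ℤ.≟ (+ a - + r)) ∨ northIn (suc r) as t

edgeSeq : List ℕ → ℤ → Bool
edgeSeq λs t = not (does (t ℤ.≤? -[1+ length λs ]) ∨ northIn 1 λs t)

IsEdgeSeq : (ℤ → Bool) → Set
IsEdgeSeq M = Σ (List ℕ) λ μ → IsPartition μ × (∀ t → M t ≡ edgeSeq μ t)

subSeq : ℕ → ℕ → ℤ → (ℤ → Bool) → ℤ → Bool
subSeq m i k M j = M ((+ m ℤ.* (j ℤ.+ k)) ℤ.+ + i)

IsShiftComponent : ℕ → List ℕ → ℕ → ℤ → Set
IsShiftComponent m λs i k =
  IsEdgeSeq (subSeq m i k (edgeSeq λs)) ×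
  (∀ k' → IsEdgeSeq (subSeq m i k' (edgeSeq λs)) → k' ≡ k)

module Submission where

-- Position t of the boundary carries a north step iff t = λ_r - r for some
-- row r ≥ 1.  A 0/1 sequence is an edge sequence iff its north steps are
-- "balanced": all positions far left, none far right, and exactly L of them
-- in a large window [-L, L).  Reading λ's boundary at m (j + k) + i for j
-- in the window, row-balance shows that adding a row of length a (moving
-- its north step from -r to a - r and adding a cells) keeps
--   #north steps read + N_{i+1} = #positions ≤ -1 read + N_i = (L - k) + N_i
-- (window-balance, north-balance).  So for k = k₀ = N_i - N_{i+1} the read
-- steps are balanced and rebuild recovers a partition from them; if some k
-- yields an edge sequence they are balanced too (north-window, the case
-- m = 1), forcing k = k₀.  The sections Counting, Integers, Boundary,
-- Window, Rebuilding and Shift are modules, so that _+_, _≤_ and _<_ can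
-- denote the ℕ- or the ℤ-operations as fits the section.

open import Defs
open import Function using (_∘_; flip; _⇔_; mk⇔; module Equivalence)
open import Data.Empty using (⊥; ⊥-elim)
open import Data.Nat as ℕ using (ℕ; zero; suc; z≤n; s≤s)
import Data.Nat.Properties as ℕP
open import Data.Nat.ListAction using (sum)
open import Data.Nat.Divisibility using (_∣_; _∣?_; 1∣_)
import Data.Nat.Tactic.RingSolver as NatSolver
open import Data.Integer as ℤ using (ℤ; +_; -[1+_]; ∣_∣; _-_; _*_; -_; +≤+; -≤+; +<+; -<+)
import Data.Integer.Properties as ℤP
open import Data.Integer.Divisibility.Signed using (divides; ∣ᵤ⇒∣; ∣⇒∣ᵤ)
open import Data.Integer.Tactic.RingSolver using (solve-∀)
open import Data.Bool using (Bool; true; false; not; _∨_; _∧_; T?)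
import Data.Bool.Properties as BoolP
open import Data.List using (List; []; _∷_; _++_; length; map; applyUpTo; filterᵇ)
import Data.List.Properties as ListP
open import Data.List.Relation.Unary.All as All using (All; []; _∷_)
open import Data.List.Relation.Unary.Linked as Linked using (Linked; []; [-]; _∷_)
import Data.List.Relation.Unary.Linked.Properties as LinkedP
open import Data.Product using (Σ; _,_; _×_; proj₁; proj₂)
open import Data.Sum using ([_,_]′)
open import Relation.Nullary using (¬_; contradiction)
open import Relation.Nullary.Decidable using (Dec; does; yes; no; does-⇔; dec-true; dec-false)
open import Relation.Binary.PropositionalEquality

-- Counting the points below n at which a Boolean predicate holds.
module Counting where

  open import Data.Nat using (_+_; _≤_; _<_)

  ⟦_⟧ : Bool → ℕ
  ⟦ true ⟧  = 1
  ⟦ false ⟧ = 0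

  witness : ∀ {A : Set} (d : Dec A) → does d ≡ true → A
  witness (yes a) _  = a
  witness (no _)  ()

  bracket-dec : ∀ {A : Set} {n} (d : Dec A) → (A → n ≡ 1) → (¬ A → n ≡ 0) → n ≡ ⟦ does d ⟧
  bracket-dec (yes a) yes-case _       = yes-case a
  bracket-dec (no ¬a) _       no-case = no-case ¬a

  count : (ℕ → Bool) → ℕ → ℕ
  count q zero    = 0
  count q (suc n) = ⟦ q 0 ⟧ + count (λ u → q (suc u)) n

  count-cong : ∀ {q q'} n → (∀ u → u < n → q u ≡ q' u) → count q n ≡ count q' n
  count-cong zero    eq = refl
  count-cong (suc n) eq =
    cong₂ _+_ (cong ⟦_⟧ (eq 0 (s≤s z≤n))) (count-cong n (λ u u<n → eq (suc u) (s≤s u<n)))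

  count-snoc : ∀ q n → count q (suc n) ≡ count q n + ⟦ q n ⟧
  count-snoc q zero    = ℕP.+-comm ⟦ q 0 ⟧ 0
  count-snoc q (suc n) = trans (cong (_+_ ⟦ q 0 ⟧) (count-snoc (λ u → q (suc u)) n))
                               (sym (ℕP.+-assoc ⟦ q 0 ⟧ _ _))

  count-last-true : ∀ q n → q n ≡ true → count q (suc n) ≡ suc (count q n)
  count-last-true q n hit =
    trans (count-snoc q n) (trans (cong (λ b → count q n + ⟦ b ⟧) hit) (ℕP.+-comm (count q n) 1))

  count-last-false : ∀ q n → q n ≡ false → count q (suc n) ≡ count q n
  count-last-false q n miss =
    trans (count-snoc q n) (trans (cong (λ b → count q n + ⟦ b ⟧) miss) (ℕP.+-identityʳ (count q n)))

  count-≤ : ∀ q n → count q n ≤ n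
  count-≤ q zero    = z≤n
  count-≤ q (suc n) = ℕP.+-mono-≤ (bracket≤1 (q 0)) (count-≤ (λ u → q (suc u)) n)
    where bracket≤1 : ∀ b → ⟦ b ⟧ ≤ 1
          bracket≤1 true  = s≤s z≤n
          bracket≤1 false = z≤n

  count-full : ∀ q n → count q n ≡ n → ∀ u → u < n → q u ≡ true
  count-full q (suc n) eq u u<n with q 0 in q0
  count-full q (suc n) eq zero    _         | true = q0
  count-full q (suc n) eq (suc u) (s≤s u<n) | true =
    count-full (λ u → q (suc u)) n (ℕP.suc-injective eq) u u<n
  count-full q (suc n) eq u       _         | false =
    contradiction (subst (_≤ n) eq (count-≤ (λ u → q (suc u)) n)) (ℕP.<-irrefl refl)

  count-none : ∀ q n → (∀ u → u < n → q u ≡ false) → count q n ≡ 0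
  count-none q zero    none = refl
  count-none q (suc n) none rewrite none 0 (s≤s z≤n) =
    count-none (λ u → q (suc u)) n (λ u u<n → none (suc u) (s≤s u<n))

  interchange : ∀ a b c d → (a + b) + (c + d) ≡ (a + c) + (b + d)
  interchange = NatSolver.solve-∀

  count-∨ : ∀ q q' n → (∀ u → q u ∧ q' u ≡ false) →
    count (λ u → q u ∨ q' u) n ≡ count q n + count q' n
  count-∨ q q' zero    disj = refl
  count-∨ q q' (suc n) disj =
    trans (cong₂ _+_ (bracket-∨ (q 0) (q' 0) (disj 0))
                     (count-∨ (λ u → q (suc u)) (λ u → q' (suc u)) n (λ u → disj (suc u))))
          (interchange ⟦ q 0 ⟧ ⟦ q' 0 ⟧ _ _)
    where
      bracket-∨ : ∀ a b → a ∧ b ≡ false → ⟦ a ∨ b ⟧ ≡ ⟦ a ⟧ + ⟦ b ⟧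
      bracket-∨ true  true  ()
      bracket-∨ true  false _ = refl
      bracket-∨ false b     _ = refl

  count-≡ : ∀ p n → p < n → count (λ u → does (u ℕP.≟ p)) n ≡ 1
  count-≡ zero    (suc n) _ = cong suc (count-none _ n (λ _ _ → refl))
  count-≡ (suc p) (suc n) (s≤s p<n) = count-≡ p n p<n

  count-< : ∀ p n → p ≤ n → count (λ u → does (u ℕP.<? p)) n ≡ p
  count-< zero    n       _         = count-none _ n (λ _ _ → refl)
  count-< (suc p) (suc n) (s≤s p≤n) = cong suc (count-< p n p≤n)

open Counting

-- Order facts about ℤ, and counting integer points of a window.
module Integers where

  open import Data.Integer using (_+_; _≤_; _<_)

  -- An integer inequality x ≤ y is witnessed by its gap y - x ∈ ℕ;
  -- inequalities are established by exhibiting the gap and checking an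
  -- identity with the ring solver.
  ≤-gap : ∀ {x y} → x ≤ y → Σ ℕ λ n → y ≡ x + + n
  ≤-gap {x} {y} x≤y =
    ∣ y - x ∣ , trans (sym (cancel x y)) (cong (λ d → x + d) (sym gap))
    where
      gap : + ∣ y - x ∣ ≡ y - x
      gap = trans (cong +_ (ℤP.∣i-j∣≡∣j-i∣ y x)) (ℤP.∣-∣-≤ x≤y)
      cancel : ∀ x y → x + (y - x) ≡ y
      cancel = solve-∀

  gap-≤ : ∀ {x y} n → y ≡ x + + n → x ≤ y
  gap-≤ {x} n refl = ℤP.i≤i+j x (+ n)

  <-gap : ∀ {x y} → x < y → Σ ℕ λ n → y ≡ x + + suc n
  <-gap {x} x<y with ≤-gap (ℤP.i<j⇒suc[i]≤j x<y)
  ... | n , eq = n , trans eq (shift x (+ n))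
    where shift : ∀ x n → (+ 1 + x) + n ≡ x + (+ 1 + n)
          shift = solve-∀

  gap-< : ∀ {x y} n → y ≡ x + + suc n → x < y
  gap-< {x} n eq = ℤP.suc[i]≤j⇒i<j (gap-≤ n (trans eq (shift x (+ n))))
    where shift : ∀ x n → x + (+ 1 + n) ≡ (+ 1 + x) + n
          shift = solve-∀

  ≤-abs : ∀ z → z ≤ + ∣ z ∣
  ≤-abs (+ n)    = ℤP.≤-refl
  ≤-abs -[1+ n ] = -≤+

  neg-abs-≤ : ∀ z → - + ∣ z ∣ ≤ z
  neg-abs-≤ (+ zero)  = ℤP.≤-refl
  neg-abs-≤ (+ suc n) = -≤+
  neg-abs-≤ -[1+ n ]  = ℤP.≤-refl

  scale-≤ : ∀ {m' i} y → i ℕ.≤ m' → y < + 0 → + suc m' * y + + i ≤ y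
  scale-≤ (+ n) _ (+<+ ())
  scale-≤ {m'} {i} -[1+ n ] i≤m' _ with ℕP.m≤n⇒∃[o]m+o≡n i≤m'
  ... | e , refl = gap-≤ (i ℕ.* n ℕ.+ e ℕ.* suc n) (begin
      -[1+ n ]
    ≡⟨ identity (+ i) (+ e) (+ n) ⟩
      (+ suc (i ℕ.+ e) * -[1+ n ] + + i) + (+ i * + n + + e * + suc n)
    ≡⟨ cong₂ (λ a b → (+ suc (i ℕ.+ e) * -[1+ n ] + + i) + (a + b))
             (sym (ℤP.pos-* i n)) (sym (ℤP.pos-* e (suc n))) ⟩
      (+ suc (i ℕ.+ e) * -[1+ n ] + + i) + + (i ℕ.* n ℕ.+ e ℕ.* suc n)
    ∎)
    where
      open ≡-Reasoning
      identity : ∀ i e n → - (+ 1 + n) ≡ ((+ 1 + (i + e)) * - (+ 1 + n) + i) + (i * n + e * (+ 1 + n))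
      identity = solve-∀

  ≤-scale : ∀ m' i y → + 0 ≤ y → y ≤ + suc m' * y + + i
  ≤-scale m' i (+ n) _ = gap-≤ (m' ℕ.* n ℕ.+ i) (begin
      + suc m' * + n + + i
    ≡⟨ cong (_+ + i) (sym (ℤP.pos-* (suc m') n)) ⟩
      + (n ℕ.+ m' ℕ.* n ℕ.+ i)
    ≡⟨ cong +_ (ℕP.+-assoc n (m' ℕ.* n) i) ⟩
      + n + + (m' ℕ.* n ℕ.+ i)
    ∎)
    where open ≡-Reasoning

  +-cancelˡ : ∀ a {x y} → a + x ≡ a + y → x ≡ y
  +-cancelˡ a {x} {y} eq = trans (identity a x) (trans (cong (_- a) eq) (sym (identity a y)))
    where identity : ∀ a x → x ≡ (a + x) - a
          identity = solve-∀

  +-cancelʳ : ∀ a {x y} → x + a ≡ y + a → x ≡ y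
  +-cancelʳ a {x} {y} eq = +-cancelˡ a (trans (ℤP.+-comm a x) (trans eq (ℤP.+-comm y a)))

  shift-≟ : ∀ a u v → does (a + + u ℤP.≟ a + + v) ≡ does (u ℕP.≟ v)
  shift-≟ a u v = does-⇔ (mk⇔ (ℤP.+-injective ∘ +-cancelˡ a) (cong (λ w → a + + w)))
                         (a + + u ℤP.≟ a + + v) (u ℕP.≟ v)

  shift-<? : ∀ a u v → does (a + + u ℤP.<? a + + v) ≡ does (u ℕP.<? v)
  shift-<? a u v = does-⇔ (mk⇔ cancel (λ u<v → ℤP.+-monoʳ-< a (+<+ u<v)))
                          (a + + u ℤP.<? a + + v) (u ℕP.<? v)
    where cancel : a + + u < a + + v → u ℕ.< v
          cancel lt with u ℕP.<? v
          ... | yes u<v = u<v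
          ... | no u≮v  = contradiction (ℤP.+-monoʳ-≤ a (+≤+ (ℕP.≮⇒≥ u≮v))) (ℤP.<⇒≱ lt)

  interval-index : ∀ {a z} n → a ≤ z → z < a + + n → Σ ℕ λ p → z ≡ a + + p × p ℕ.< n
  interval-index {a} {z} n a≤z z<a+n with ≤-gap a≤z | <-gap z<a+n
  ... | p , refl | d , eq = p , refl , ℕP.≤-trans (ℕP.m≤m+n (suc p) d) (ℕP.≤-reflexive (ℤP.+-injective n≡p+1+d))
    where
      identity : ∀ a p d → (a + p) + (+ 1 + d) ≡ a + ((+ 1 + p) + d)
      identity = solve-∀
      n≡p+1+d : + (suc p ℕ.+ d) ≡ + n
      n≡p+1+d = sym (+-cancelˡ a (trans eq (identity a (+ p) (+ d))))

  abs<⇒bounds : ∀ {z n} → ∣ z ∣ ℕ.< n → - + n ≤ z × z < + n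
  abs<⇒bounds {z} z<n =
    ℤP.≤-trans (ℤP.neg-mono-≤ (+≤+ (ℕP.<⇒≤ z<n))) (neg-abs-≤ z) , ℤP.≤-<-trans (≤-abs z) (+<+ z<n)

  ≤-split : ∀ t x → does (t ℤP.≤? x) ≡ does (t ℤP.≟ x) ∨ does (t ℤP.≤? ℤ.pred x)
  ≤-split t x with t ℤP.≟ x
  ... | yes refl = dec-true (t ℤP.≤? t) ℤP.≤-refl
  ... | no t≢x   = does-⇔ (mk⇔ (λ t≤x → ℤP.i<j⇒i≤pred[j] (ℤP.≤∧≢⇒< t≤x t≢x))
                                (λ t≤x-1 → ℤP.<⇒≤ (ℤP.i≤pred[j]⇒i<j t≤x-1)))
                           (t ℤP.≤? x) (t ℤP.≤? ℤ.pred x)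

  ≤-split-disjoint : ∀ t x → does (t ℤP.≟ x) ∧ does (t ℤP.≤? ℤ.pred x) ≡ false
  ≤-split-disjoint t x with t ℤP.≟ x
  ... | no _     = refl
  ... | yes refl = dec-false (t ℤP.≤? ℤ.pred t) (ℤP.<⇒≱ (ℤP.i≤pred[j]⇒i<j ℤP.≤-refl))

  count-point : ∀ a z n → a ≤ z → z < a + + n → count (λ u → does (a + + u ℤP.≟ z)) n ≡ 1
  count-point a z n a≤z z<a+n with interval-index n a≤z z<a+n
  ... | p , refl , p<n = trans (count-cong n (λ u _ → shift-≟ a u p)) (count-≡ p n p<n)

  count-before : ∀ a p n → p ℕ.≤ n → count (λ u → does (a + + u ℤP.<? a + + p)) n ≡ p
  count-before a p n p≤n = trans (count-cong n (λ u _ → shift-<? a u p)) (count-< p n p≤n)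

  <-neg⇔ : ∀ y k → y < - k ⇔ y + k < + 0
  <-neg⇔ y k = mk⇔ (λ lt → subst (y + k <_) (ℤP.+-inverseˡ k) (ℤP.+-monoˡ-< k lt))
                   (λ lt → subst₂ _<_ (identity y k) (ℤP.+-identityˡ (- k)) (ℤP.+-monoˡ-< (- k) {y + k} {+ 0} lt))
    where identity : ∀ y k → (y + k) - k ≡ y
          identity = solve-∀

open Integers

-- North steps and cell classes of a Young diagram, row by row.
module Boundary where

  open import Data.Integer using (_+_; _≤_; _<_)

  -- north r as t: the boundary of the diagram whose rows r, r+1, … have the
  -- lengths as (and are empty afterwards) has a north step at position t.
  north : ℕ → List ℕ → ℤ → Bool
  north r as t = does (t ℤP.≤? - + (r ℕ.+ length as)) ∨ northIn r as t

  edgeSeq-north : ∀ λs t → edgeSeq λs t ≡ not (north 1 λs t)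
  edgeSeq-north λs t = refl

  north-[] : ∀ r t → north r [] t ≡ does (t ℤP.≤? - + r)
  north-[] r t = trans (cong (λ n → does (t ℤP.≤? - + n) ∨ false) (ℕP.+-identityʳ r))
                       (BoolP.∨-identityʳ _)

  north-∷ : ∀ r a as t → north r (a ∷ as) t ≡ does (t ℤP.≟ + a - + r) ∨ north (suc r) as t
  north-∷ r a as t
    rewrite ℕP.+-suc r (length as) =
    swap (does (t ℤP.≤? - + suc (r ℕ.+ length as))) (does (t ℤP.≟ + a - + r)) (northIn (suc r) as t)
    where swap : ∀ x y z → x ∨ (y ∨ z) ≡ y ∨ (x ∨ z)
          swap x y z = trans (sym (BoolP.∨-assoc x y z))
                       (trans (cong (_∨ z) (BoolP.∨-comm x y)) (BoolP.∨-assoc y x z))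

  north-upper : ∀ B r as t → All (ℕ._≤ B) as → north (suc r) as t ≡ true → t < + B - + r
  north-upper B r [] t [] nt =
    ℤP.≤-<-trans (witness (t ℤP.≤? - + suc r) (trans (sym (north-[] (suc r) t)) nt))
                 (gap-< B (identity (+ B) (+ r)))
    where identity : ∀ B r → B - r ≡ - (+ 1 + r) + (+ 1 + B)
          identity = solve-∀
  north-upper B r (b ∷ bs) t (b≤B ∷ bs≤B) nt
    rewrite north-∷ (suc r) b bs t with t ℤP.≟ + b - + suc r
  ... | yes refl with ℕP.m≤n⇒∃[o]m+o≡n b≤B
  ...   | d , refl = gap-< d (identity (+ b) (+ d) (+ r))
    where identity : ∀ b d r → (b + d) - r ≡ (b - (+ 1 + r)) + (+ 1 + d)
          identity = solve-∀
  north-upper B r (b ∷ bs) t (b≤B ∷ bs≤B) nt | no _ =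
    ℤP.<-trans (north-upper B (suc r) bs t bs≤B nt) (gap-< 0 (identity (+ B) (+ r)))
    where identity : ∀ B r → B - r ≡ (B - (+ 1 + r)) + + 1
          identity = solve-∀

  classCells : ℕ → ℕ → ℕ → List ℕ → ℕ
  classCells m j r as = length (filterᵇ (congMod m j) (cellsFrom r as))

  rowCells : ℕ → ℕ → ℕ → ℕ → ℕ
  rowCells m j r a = count (λ c → congMod m j (r , suc c)) a

  length-filter-row : ∀ {A : Set} (p : A → Bool) (g : ℕ → A) a →
    length (filterᵇ p (applyUpTo g a)) ≡ count (p ∘ g) a
  length-filter-row p g zero    = refl
  length-filter-row p g (suc a) with p (g 0)
  ... | true  = cong suc (length-filter-row p (g ∘ suc) a)
  ... | false = length-filter-row p (g ∘ suc) a

  classCells-∷ : ∀ m j r a as →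
    classCells m j r (a ∷ as) ≡ rowCells m j r a ℕ.+ classCells m j (suc r) as
  classCells-∷ m j r a as = begin
      length (filterᵇ p (row ++ cellsFrom (suc r) as))
    ≡⟨ cong length (ListP.filter-++ (T? ∘ p) row (cellsFrom (suc r) as)) ⟩
      length (filterᵇ p row ++ filterᵇ p (cellsFrom (suc r) as))
    ≡⟨ ListP.length-++ (filterᵇ p row) ⟩
      length (filterᵇ p row) ℕ.+ classCells m j (suc r) as
    ≡⟨ cong (ℕ._+ classCells m j (suc r) as)
            (trans (cong (length ∘ filterᵇ p) (ListP.map-applyUpTo suc (λ c → r , c) a))
                   (length-filter-row p (λ c → r , suc c) a)) ⟩
      rowCells m j r a ℕ.+ classCells m j (suc r) as
    ∎
    where
      open ≡-Reasoning
      p : ℕ × ℕ → Bool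
      p = congMod m j
      row : List (ℕ × ℕ)
      row = map (λ c → r , c) (applyUpTo suc a)

  inClass : ℕ → ℕ → ℤ → Bool
  inClass m i x = does (m ∣? ∣ x - + i ∣)

  -- Adding row r of length a moves its north step from -r to a - r.
  -- Together with the a new cells, whose contents -r+1, …, a-r are one step
  -- above the positions -r, …, a-r-1, this balances class i against i+1:
  -- [−r ∈ i] + #{cells in class i} = [a−r ∈ i] + #{cells in class i+1}.
  row-balance : ∀ m i r a →
    ⟦ inClass m i (- + r) ⟧ ℕ.+ rowCells m i r a ≡ ⟦ inClass m i (+ a - + r) ⟧ ℕ.+ rowCells m (suc i) r a
  row-balance m i r a = begin
      ⟦ inClass m i (- + r) ⟧ ℕ.+ rowCells m i r a
    ≡⟨ cong (λ x → ⟦ inClass m i x ⟧ ℕ.+ rowCells m i r a) (sym (ℤP.+-identityˡ (- + r))) ⟩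
      count content (suc a)
    ≡⟨ count-snoc content a ⟩
      count content a ℕ.+ ⟦ content a ⟧
    ≡⟨ ℕP.+-comm (count content a) _ ⟩
      ⟦ inClass m i (+ a - + r) ⟧ ℕ.+ count content a
    ≡⟨ cong (⟦ inClass m i (+ a - + r) ⟧ ℕ.+_)
            (count-cong a (λ c _ → cong (λ x → does (m ∣? ∣ x ∣)) (shift (+ c) (+ r) (+ i)))) ⟩
      ⟦ inClass m i (+ a - + r) ⟧ ℕ.+ rowCells m (suc i) r a
    ∎
    where
      open ≡-Reasoning
      content : ℕ → Bool
      content c = congMod m i (r , c)
      shift : ∀ c r i → (c - r) - i ≡ ((+ 1 + c) - r) - (+ 1 + i)
      shift = solve-∀

  rows-below : ∀ a as → Linked ℕ._≥_ (a ∷ as) → All (ℕ._≤ a) as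
  rows-below a []       _  = []
  rows-below a (b ∷ bs) lk = LinkedP.Linked⇒All (flip ℕP.≤-trans) (Linked.head lk) (Linked.tail lk)

  -- The north step of row r lies strictly above those of later rows.
  north-∷-disjoint : ∀ r a as t → All (ℕ._≤ a) as →
    does (t ℤP.≟ + a - + r) ∧ north (suc r) as t ≡ false
  north-∷-disjoint r a as t as≤a with t ℤP.≟ + a - + r | north (suc r) as t in later
  ... | no _     | _     = refl
  ... | yes _    | false = refl
  ... | yes refl | true  = contradiction (north-upper a r as t as≤a later) (ℤP.<-irrefl refl)

  north-below-rows : ∀ r as t → t ≤ - + (r ℕ.+ length as) → north r as t ≡ true
  north-below-rows r as t deep rewrite dec-true (t ℤP.≤? - + (r ℕ.+ length as)) deep = refl

open Boundary

-- Reading the boundary of λ through the i-th quotient with shift k: the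
-- window point j ∈ [-L, L) reads position m (j + k) + i.  B bounds the
-- number and the lengths of the rows, and L is large compared to B.
module Window (m' i : ℕ) (i<m : i ℕ.< suc m') (k : ℤ) (B L : ℕ)
              (large : B ℕ.+ i ℕ.+ ∣ k ∣ ℕ.< L) where

  open import Data.Integer using (_+_; _≤_; _<_)

  m : ℕ
  m = suc m'

  i≤m' : i ℕ.≤ m'
  i≤m' = ℕP.≤-pred i<m

  sample : ℤ → ℤ
  sample j = + m * (j + k) + + i

  pos : ℕ → ℤ
  pos u = - + L + + u

  reads : (ℤ → Bool) → ℕ
  reads P = count (λ u → P (sample (pos u))) (L ℕ.+ L)

  ind : ℤ → ℕ
  ind x = ⟦ inClass m i x ⟧

  -- sample j ≤ -1 exactly when j + k < 0: sample stretches ℤ away from the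
  -- gap between -1 and 0.
  sample-neg : ∀ y → sample y ≤ - + 1 ⇔ y + k < + 0
  sample-neg y = mk⇔ to (λ y+k<0 → ℤP.≤-trans (scale-≤ (y + k) i≤m' y+k<0) (ℤP.i<j⇒i≤pred[j] y+k<0))
    where
      to : sample y ≤ - + 1 → y + k < + 0
      to le with y + k ℤP.<? + 0
      ... | yes y+k<0 = y+k<0
      ... | no y+k≮0  =
        contradiction (ℤP.≤-trans (ℤP.≮⇒≥ y+k≮0) (ℤP.≤-trans (≤-scale m' i (y + k) (ℤP.≮⇒≥ y+k≮0)) le)) (λ ())

  sample-≡ : ∀ {x q} → x - + i ≡ q * + m → ∀ y → sample y ≡ x ⇔ y ≡ q - k
  sample-≡ {x} {q} x-i≡qm y = mk⇔
    (λ hit → trans (identity₁ y k) (cong (_- k) (ℤP.*-cancelʳ-≡ (y + k) q (+ m)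
               (trans (sym (identity₂ (+ m) (y + k) (+ i))) (trans (cong (_- + i) hit) x-i≡qm)))))
    (λ { refl → trans (identity₃ (+ m) q k (+ i)) (trans (cong (_+ + i) (sym x-i≡qm)) (identity₄ x (+ i))) })
    where
      identity₁ : ∀ y k → y ≡ (y + k) - k
      identity₁ = solve-∀
      identity₂ : ∀ m z i → (m * z + i) - i ≡ z * m
      identity₂ = solve-∀
      identity₃ : ∀ m q k i → m * ((q - k) + k) + i ≡ q * m + i
      identity₃ = solve-∀
      identity₄ : ∀ x i → (x - i) + i ≡ x
      identity₄ = solve-∀

  quotient-in-window : ∀ {x q} → ∣ x ∣ ℕ.≤ B → x - + i ≡ q * + m → ∣ q - k ∣ ℕ.< L
  quotient-in-window {x} {q} x≤B x-i≡qm = begin-strict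
      ∣ q - k ∣                   ≤⟨ ℤP.∣i-j∣≤∣i∣+∣j∣ q k ⟩
      ∣ q ∣ ℕ.+ ∣ k ∣             ≤⟨ ℕP.+-monoˡ-≤ ∣ k ∣ q≤x-i ⟩
      ∣ x - + i ∣ ℕ.+ ∣ k ∣       ≤⟨ ℕP.+-monoˡ-≤ ∣ k ∣ (ℕP.≤-trans (ℤP.∣i-j∣≤∣i∣+∣j∣ x (+ i)) (ℕP.+-monoˡ-≤ i x≤B)) ⟩
      B ℕ.+ i ℕ.+ ∣ k ∣           <⟨ large ⟩
      L                           ∎
    where
      open ℕP.≤-Reasoning
      q≤x-i : ∣ q ∣ ℕ.≤ ∣ x - + i ∣
      q≤x-i = subst (∣ q ∣ ℕ.≤_) (trans (sym (ℤP.abs-* q (+ m))) (cong ∣_∣ (sym x-i≡qm))) (ℕP.m≤m*n ∣ q ∣ m)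

  reads-point : ∀ x → ∣ x ∣ ℕ.≤ B → reads (λ t → does (t ℤP.≟ x)) ≡ ind x
  reads-point x x≤B = bracket-dec (m ∣? ∣ x - + i ∣) once never
    where
      never : ¬ (m ∣ ∣ x - + i ∣) → reads (λ t → does (t ℤP.≟ x)) ≡ 0
      never m∤x-i = count-none _ (L ℕ.+ L) λ u _ →
        dec-false (sample (pos u) ℤP.≟ x)
                  (λ { refl → m∤x-i (∣⇒∣ᵤ {+ m} {x - + i} (divides (pos u + k) (identity (+ m) (pos u + k) (+ i)))) })
        where identity : ∀ m z i → (m * z + i) - i ≡ z * m
              identity = solve-∀
      once : m ∣ ∣ x - + i ∣ → reads (λ t → does (t ℤP.≟ x)) ≡ 1
      once m∣x-i with ∣ᵤ⇒∣ {+ m} {x - + i} m∣x-i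
      ... | divides q x-i≡qm =
        trans (count-cong (L ℕ.+ L) λ u _ →
                 does-⇔ (sample-≡ {x} {q} x-i≡qm (pos u)) (sample (pos u) ℤP.≟ x) (pos u ℤP.≟ q - k))
              (count-point (- + L) (q - k) (L ℕ.+ L) (proj₁ bounds) (subst (q - k <_) (identity (+ L)) (proj₂ bounds)))
        where
          bounds : - + L ≤ q - k × q - k < + L
          bounds = abs<⇒bounds (quotient-in-window {x} {q} x≤B x-i≡qm)
          identity : ∀ L → L ≡ - L + (L + L)
          identity = solve-∀

  readsBelow : ℕ → ℕ
  readsBelow r = reads (λ t → does (t ℤP.≤? - + r))

  readsNorth : ℕ → List ℕ → ℕ
  readsNorth r as = reads (north r as)

  -k-index : Σ ℕ λ p → - k ≡ - + L + + p × p ℕ.≤ L ℕ.+ L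
  -k-index with interval-index (suc (L ℕ.+ L)) (proj₁ -k-bounds)
                               (ℤP.<-trans (proj₂ -k-bounds) (gap-< 0 (identity (+ L))))
    where
      -k-bounds : - + L ≤ - k × - k < + L
      -k-bounds = abs<⇒bounds (subst (ℕ._< L) (sym (ℤP.∣-i∣≡∣i∣ k))
                                     (ℕP.≤-trans (s≤s (ℕP.m≤n+m ∣ k ∣ (B ℕ.+ i))) large))
      identity : ∀ L → - L + (+ 1 + (L + L)) ≡ L + (+ 1 + + 0)
      identity = solve-∀
  ... | p , -k≡-L+p , p<2L+1 = p , -k≡-L+p , ℕP.≤-pred p<2L+1

  -- Exactly the window points j < -k read a position ≤ -1; there are L - k.
  readsBelow-1 : + readsBelow 1 ≡ + L - k
  readsBelow-1 with -k-index
  ... | p , -k≡-L+p , p≤2L = begin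
      + readsBelow 1
    ≡⟨ cong +_ (count-cong (L ℕ.+ L) λ u _ →
                  trans (does-⇔ (sample-below (pos u)) (sample (pos u) ℤP.≤? - + 1) (pos u ℤP.<? - k))
                        (cong (λ z → does (pos u ℤP.<? z)) -k≡-L+p)) ⟩
      + count (λ u → does (pos u ℤP.<? - + L + + p)) (L ℕ.+ L)
    ≡⟨ cong +_ (count-before (- + L) p (L ℕ.+ L) p≤2L) ⟩
      + p
    ≡⟨ sym (trans (cong (λ z → + L + z) -k≡-L+p) (identity (+ L) (+ p))) ⟩
      + L - k
    ∎
    where
      open ≡-Reasoning
      sample-below : ∀ y → sample y ≤ - + 1 ⇔ y < - k
      sample-below y = mk⇔ (Equivalence.from (<-neg⇔ y k) ∘ Equivalence.to (sample-neg y))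
                           (Equivalence.from (sample-neg y) ∘ Equivalence.to (<-neg⇔ y k))
      identity : ∀ L p → L + (- L + p) ≡ p
      identity = solve-∀

  below-split : ∀ r → r ℕ.≤ B → readsBelow r ≡ ind (- + r) ℕ.+ readsBelow (suc r)
  below-split r r≤B = begin
      readsBelow r
    ≡⟨ count-cong (L ℕ.+ L) (λ u _ → split (sample (pos u))) ⟩
      reads (λ t → does (t ℤP.≟ - + r) ∨ does (t ℤP.≤? - + suc r))
    ≡⟨ count-∨ _ _ (L ℕ.+ L) (λ u → disjoint (sample (pos u))) ⟩
      reads (λ t → does (t ℤP.≟ - + r)) ℕ.+ readsBelow (suc r)
    ≡⟨ cong (ℕ._+ readsBelow (suc r)) (reads-point (- + r) (subst (ℕ._≤ B) (sym (ℤP.∣-i∣≡∣i∣ (+ r))) r≤B)) ⟩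
      ind (- + r) ℕ.+ readsBelow (suc r)
    ∎
    where
      open ≡-Reasoning
      split : ∀ t → does (t ℤP.≤? - + r) ≡ does (t ℤP.≟ - + r) ∨ does (t ℤP.≤? - + suc r)
      split t = subst (λ z → does (t ℤP.≤? - + r) ≡ does (t ℤP.≟ - + r) ∨ does (t ℤP.≤? z))
                      (sym (ℤP.neg-suc r)) (≤-split t (- + r))
      disjoint : ∀ t → does (t ℤP.≟ - + r) ∧ does (t ℤP.≤? - + suc r) ≡ false
      disjoint t = subst (λ z → does (t ℤP.≟ - + r) ∧ does (t ℤP.≤? z) ≡ false)
                         (sym (ℤP.neg-suc r)) (≤-split-disjoint t (- + r))

  north-step : ∀ r a as → All (ℕ._≤ a) as → ∣ + a - + r ∣ ℕ.≤ B →
    readsNorth r (a ∷ as) ≡ ind (+ a - + r) ℕ.+ readsNorth (suc r) as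
  north-step r a as as≤a a-r≤B = begin
      readsNorth r (a ∷ as)
    ≡⟨ count-cong (L ℕ.+ L) (λ u _ → north-∷ r a as (sample (pos u))) ⟩
      reads (λ t → does (t ℤP.≟ + a - + r) ∨ north (suc r) as t)
    ≡⟨ count-∨ _ _ (L ℕ.+ L) (λ u → north-∷-disjoint r a as (sample (pos u)) as≤a) ⟩
      reads (λ t → does (t ℤP.≟ + a - + r)) ℕ.+ readsNorth (suc r) as
    ≡⟨ cong (ℕ._+ readsNorth (suc r) as) (reads-point (+ a - + r) a-r≤B) ⟩
      ind (+ a - + r) ℕ.+ readsNorth (suc r) as
    ∎
    where open ≡-Reasoning

  -- The heart of the argument: by row-balance, row after row, the north
  -- steps of the rows ≥ r read by the window plus the cells of class i+1
  -- equal the positions ≤ -r read by the window plus the cells of class i.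
  window-balance : ∀ r as → Linked ℕ._≥_ as → All (ℕ._≤ B) as → r ℕ.+ length as ℕ.≤ B →
    readsNorth r as ℕ.+ classCells m (suc i) r as ≡ readsBelow r ℕ.+ classCells m i r as
  window-balance r [] _ _ _ = cong (ℕ._+ 0) (count-cong (L ℕ.+ L) (λ u _ → north-[] r (sample (pos u))))
  window-balance r (a ∷ as) sorted (a≤B ∷ as≤B) r+ℓ≤B = begin
      readsNorth r (a ∷ as) ℕ.+ C (suc i) r (a ∷ as)
    ≡⟨ cong₂ ℕ._+_ (north-step r a as (rows-below a as sorted) a-r≤B) (classCells-∷ m (suc i) r a as) ⟩
      (ind (+ a - + r) ℕ.+ readsNorth (suc r) as) ℕ.+ (rowCells m (suc i) r a ℕ.+ C (suc i) (suc r) as)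
    ≡⟨ interchange (ind (+ a - + r)) (readsNorth (suc r) as) (rowCells m (suc i) r a) (C (suc i) (suc r) as) ⟩
      (ind (+ a - + r) ℕ.+ rowCells m (suc i) r a) ℕ.+ (readsNorth (suc r) as ℕ.+ C (suc i) (suc r) as)
    ≡⟨ cong₂ ℕ._+_ (sym (row-balance m i r a)) (window-balance (suc r) as (Linked.tail sorted) as≤B r+ℓ≤B′) ⟩
      (ind (- + r) ℕ.+ rowCells m i r a) ℕ.+ (readsBelow (suc r) ℕ.+ C i (suc r) as)
    ≡⟨ interchange (ind (- + r)) (rowCells m i r a) (readsBelow (suc r)) (C i (suc r) as) ⟩
      (ind (- + r) ℕ.+ readsBelow (suc r)) ℕ.+ (rowCells m i r a ℕ.+ C i (suc r) as)
    ≡⟨ cong₂ ℕ._+_ (sym (below-split r r≤B)) (sym (classCells-∷ m i r a as)) ⟩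
      readsBelow r ℕ.+ C i r (a ∷ as)
    ∎
    where
      open ≡-Reasoning
      C : ℕ → ℕ → List ℕ → ℕ
      C = classCells m
      r≤B : r ℕ.≤ B
      r≤B = ℕP.≤-trans (ℕP.m≤m+n r (length (a ∷ as))) r+ℓ≤B
      r+ℓ≤B′ : suc r ℕ.+ length as ℕ.≤ B
      r+ℓ≤B′ = subst (ℕ._≤ B) (ℕP.+-suc r (length as)) r+ℓ≤B
      a-r≤B : ∣ + a - + r ∣ ℕ.≤ B
      a-r≤B = subst (ℕ._≤ B) (cong ∣_∣ (sym (ℤP.[+m]-[+n]≡m⊖n a r)))
                    (ℕP.≤-trans (ℤP.∣m⊝n∣≤m⊔n a r) (ℕP.⊔-lub a≤B r≤B))

  north-balance : ∀ λs → Linked ℕ._≥_ λs → All (ℕ._≤ B) λs → suc (length λs) ℕ.≤ B →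
    + readsNorth 1 λs + k ≡ + L + (+ N m λs i - + N m λs (suc i))
  north-balance λs sorted λs≤B ℓ<B = begin
      + readsNorth 1 λs + k
    ≡⟨ identity₁ (+ readsNorth 1 λs) (+ N m λs (suc i)) k ⟩
      + (readsNorth 1 λs ℕ.+ N m λs (suc i)) - + N m λs (suc i) + k
    ≡⟨ cong (λ n → + n - + N m λs (suc i) + k) (window-balance 1 λs sorted λs≤B ℓ<B) ⟩
      (+ readsBelow 1 + + N m λs i) - + N m λs (suc i) + k
    ≡⟨ cong (λ z → (z + + N m λs i) - + N m λs (suc i) + k) readsBelow-1 ⟩
      ((+ L - k) + + N m λs i) - + N m λs (suc i) + k
    ≡⟨ identity₂ (+ L) k (+ N m λs i) (+ N m λs (suc i)) ⟩
      + L + (+ N m λs i - + N m λs (suc i))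
    ∎
    where
      open ≡-Reasoning
      identity₁ : ∀ p n k → p + k ≡ (p + n) - n + k
      identity₁ = solve-∀
      identity₂ : ∀ L k n₀ n₁ → ((L - k) + n₀) - n₁ + k ≡ L + (n₀ - n₁)
      identity₂ = solve-∀

  -- Left of the window every sample lies below the last row, hence is a
  -- north step.
  north-left : ∀ λs → suc (length λs) ℕ.≤ B → ∀ j → j < - + L → north 1 λs (sample j) ≡ true
  north-left λs ℓ<B j j<-L =
    north-below-rows 1 λs (sample j) (ℤP.≤-trans (scale-≤ (j + k) i≤m' (ℤP.≤-<-trans j+k≤ -<+)) j+k≤)
    where
      ℓ : ℕ
      ℓ = length λs
      ℓ+k≤L : + (ℓ ℕ.+ ∣ k ∣) ≤ + L
      ℓ+k≤L = +≤+ (ℕP.<⇒≤ (ℕP.<-trans (ℕP.+-monoˡ-< ∣ k ∣ (ℕP.≤-trans ℓ<B (ℕP.m≤m+n B i))) large))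
      j+k<-ℓ : j + k < - + ℓ
      j+k<-ℓ = begin-strict
          j + k                          ≤⟨ ℤP.+-monoʳ-≤ j (≤-abs k) ⟩
          j + + ∣ k ∣                    <⟨ ℤP.+-monoˡ-< (+ ∣ k ∣) j<-L ⟩
          - + L + + ∣ k ∣                ≤⟨ ℤP.+-monoˡ-≤ (+ ∣ k ∣) (ℤP.neg-mono-≤ ℓ+k≤L) ⟩
          - + (ℓ ℕ.+ ∣ k ∣) + + ∣ k ∣    ≡⟨ identity (+ ℓ) (+ ∣ k ∣) ⟩
          - + ℓ                          ∎
        where
          open ℤP.≤-Reasoning
          identity : ∀ ℓ k → - (ℓ + k) + k ≡ - ℓ
          identity = solve-∀
      j+k≤ : j + k ≤ - + suc ℓ
      j+k≤ = subst (j + k ≤_) (sym (ℤP.neg-suc ℓ)) (ℤP.i<j⇒i≤pred[j] j+k<-ℓ)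

  -- Right of the window every sample lies beyond the first row, hence is
  -- not a north step.
  north-right : ∀ λs → All (ℕ._≤ B) λs → ∀ j → + L ≤ j → north 1 λs (sample j) ≡ false
  north-right λs λs≤B j L≤j with north 1 λs (sample j) in is-north
  ... | false = refl
  ... | true  = contradiction (north-upper B 0 λs (sample j) λs≤B is-north)
                              (ℤP.≤⇒≯ (subst (_≤ sample j) (sym (ℤP.+-identityʳ (+ B))) B≤sample))
    where
      B+k≤L : B ℕ.+ ∣ k ∣ ℕ.≤ L
      B+k≤L = ℕP.<⇒≤ (ℕP.≤-<-trans (ℕP.+-monoˡ-≤ ∣ k ∣ (ℕP.m≤m+n B i)) large)
      B≤j+k : + B ≤ j + k
      B≤j+k = begin
          + B                            ≡⟨ identity (+ B) (+ ∣ k ∣) ⟩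
          + (B ℕ.+ ∣ k ∣) - + ∣ k ∣      ≤⟨ ℤP.+-monoˡ-≤ (- + ∣ k ∣) (+≤+ B+k≤L) ⟩
          + L - + ∣ k ∣                  ≤⟨ ℤP.+-mono-≤ L≤j (neg-abs-≤ k) ⟩
          j + k                          ∎
        where
          open ℤP.≤-Reasoning
          identity : ∀ B k → B ≡ (B + k) - k
          identity = solve-∀
      B≤sample : + B ≤ sample j
      B≤sample = ℤP.≤-trans B≤j+k (≤-scale m' i (j + k) (ℤP.≤-trans (+≤+ z≤n) B≤j+k))

-- Every balanced predicate is the north set of a partition.
module Rebuilding where

  open import Data.Integer using (_+_; _≤_; _<_)

  RowsFrom : ℕ → ℕ → (ℤ → Bool) → Set
  RowsFrom r n P = Σ (List ℕ) λ μ →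
    Linked ℕ._≥_ μ × All (0 ℕ.<_) μ × All (ℕ._≤ n) μ × (∀ t → P t ≡ north r μ t)

  -- A predicate P that holds everywhere below a, nowhere from a + n + c on,
  -- and at exactly c of the points of [a, a + n + c), where a + c = 1 - r:
  -- the shape of the north steps of a diagram with rows r, r+1, … of length
  -- at most n.
  record Balanced (P : ℤ → Bool) (a : ℤ) (c r n : ℕ) : Set where
    field
      anchor   : a + + c ≡ + 1 - + r
      left     : ∀ t → t < a → P t ≡ true
      right    : ∀ u → n ℕ.+ c ℕ.≤ u → P (a + + u) ≡ false
      balanced : count (λ u → P (a + + u)) (n ℕ.+ c) ≡ c

  remove : ℤ → (ℤ → Bool) → ℤ → Bool
  remove s P t = P t ∧ not (does (t ℤP.≟ s))

  module _ {P : ℤ → Bool} {a : ℤ} where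

    no-rows : ∀ {c r} → Balanced P a c r 0 → ∀ t → P t ≡ north r [] t
    no-rows {c} {r} b t = trans (by-position t) (trans (sym (below⇔ t)) (sym (north-[] r t)))
      where
        open Balanced b
        below⇔ : ∀ t → does (t ℤP.≤? - + r) ≡ does (t ℤP.<? a + + c)
        below⇔ t = does-⇔ (mk⇔ (λ t≤-r → ℤP.≤-<-trans t≤-r (gap-< 0 (trans anchor (identity₁ (+ r)))))
                               (λ t<a+c → subst (t ≤_) (trans (cong ℤ.pred anchor) (identity₂ (+ r)))
                                                (ℤP.i<j⇒i≤pred[j] t<a+c)))
                          (t ℤP.≤? - + r) (t ℤP.<? a + + c)
          where identity₁ : ∀ r → + 1 - r ≡ - r + (+ 1 + + 0)
                identity₁ = solve-∀
                identity₂ : ∀ r → - + 1 + (+ 1 - r) ≡ - r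
                identity₂ = solve-∀
        by-position : ∀ t → P t ≡ does (t ℤP.<? a + + c)
        by-position t with t ℤP.<? a
        ... | yes t<a = trans (left t t<a) (sym (dec-true (t ℤP.<? a + + c) (ℤP.<-≤-trans t<a (ℤP.i≤i+j a (+ c)))))
        ... | no t≮a with ≤-gap (ℤP.≮⇒≥ t≮a)
        ...   | u , refl with u ℕP.<? c
        ...     | yes u<c = trans (count-full _ c balanced u u<c) (sym (trans (shift-<? a u c) (dec-true (u ℕP.<? c) u<c)))
        ...     | no u≮c  = trans (right u (ℕP.≮⇒≥ u≮c)) (sym (trans (shift-<? a u c) (dec-false (u ℕP.<? c) u≮c)))

    drop-top : ∀ {c r n} → Balanced P a c r (suc n) → P (a + + (n ℕ.+ c)) ≡ false → Balanced P a c r n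
    drop-top {c} {r} {n} b top = record
      { anchor   = anchor
      ; left     = left
      ; right    = λ u n+c≤u → [ (λ n+c<u → right u n+c<u) , (λ { refl → top }) ]′ (ℕP.m≤n⇒m<n∨m≡n n+c≤u)
      ; balanced = trans (sym (count-last-false Q (n ℕ.+ c) top)) balanced
      }
      where
        open Balanced b
        Q : ℕ → Bool
        Q u = P (a + + u)

    no-top : ∀ {r n} → Balanced P a 0 r (suc n) → P (a + + (n ℕ.+ 0)) ≡ true → ⊥
    no-top {n = n} b top with trans (sym (count-last-true Q (n ℕ.+ 0) top)) (Balanced.balanced b)
      where Q : ℕ → Bool
            Q u = P (a + + u)
    ... | ()

    -- If the last point s of the window is in P, it is the north step of
    -- row r (of length n); removing it leaves a balanced predicate for the
    -- rows from r + 1 on.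
    remove-top : ∀ {c r n} → Balanced P a (suc c) r (suc n) → P (a + + (n ℕ.+ suc c)) ≡ true →
      Balanced (remove (a + + (n ℕ.+ suc c)) P) a c (suc r) (suc n)
    remove-top {c} {r} {n} b top = record
      { anchor   = trans (identity a (+ c)) (trans (cong (_- + 1) anchor) (identity′ (+ r)))
      ; left     = λ t t<a → trans (cong (_∧ _) (left t t<a))
                                   (cong not (dec-false (t ℤP.≟ s) (λ { refl → ℤP.<⇒≱ t<a (ℤP.i≤i+j a (+ top-index)) })))
      ; right    = λ u n+c<u → [ (λ h<u → cong (_∧ _) (right u h<u)) , (λ { refl → removed-false }) ]′
                                   (ℕP.m≤n⇒m<n∨m≡n (subst (ℕ._≤ u) (sym (ℕP.+-suc n c)) n+c<u))
      ; balanced = begin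
          count Q′ (suc (n ℕ.+ c))   ≡⟨ cong (count Q′) (sym (ℕP.+-suc n c)) ⟩
          count Q′ top-index         ≡⟨ count-cong top-index below-top ⟩
          count Q top-index          ≡⟨ ℕP.suc-injective (trans (sym (count-last-true Q top-index top)) balanced) ⟩
          c                          ∎
      }
      where
        open Balanced b
        open ≡-Reasoning
        top-index : ℕ
        top-index = n ℕ.+ suc c
        s : ℤ
        s = a + + top-index
        Q : ℕ → Bool
        Q u = P (a + + u)
        Q′ : ℕ → Bool
        Q′ u = remove s P (a + + u)
        removed-false : remove s P s ≡ false
        removed-false rewrite dec-true (s ℤP.≟ s) refl = BoolP.∧-zeroʳ (P s)
        below-top : ∀ u → u ℕ.< top-index → Q′ u ≡ Q u
        below-top u u<h
          rewrite dec-false (a + + u ℤP.≟ s) (λ eq → ℕP.<-irrefl (ℤP.+-injective (+-cancelˡ a eq)) u<h) =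
            BoolP.∧-identityʳ (Q u)
        identity : ∀ a c → a + c ≡ (a + (+ 1 + c)) - + 1
        identity = solve-∀
        identity′ : ∀ r → (+ 1 - r) - + 1 ≡ + 1 - (+ 1 + r)
        identity′ = solve-∀

    add-row : ∀ {c r n} → Balanced P a (suc c) r (suc n) → P (a + + (n ℕ.+ suc c)) ≡ true →
      RowsFrom (suc r) (suc n) (remove (a + + (n ℕ.+ suc c)) P) → RowsFrom r (suc n) P
    add-row {c} {r} {n} b top (μ , sorted , positive , bounded , rest) =
      suc n ∷ μ , linked-∷ bounded sorted , s≤s z≤n ∷ positive , ℕP.≤-refl ∷ bounded , λ t → begin
        P t                                                    ≡⟨ split t ⟩
        does (t ℤP.≟ s) ∨ remove s P t                         ≡⟨ cong₂ _∨_ (cong (λ z → does (t ℤP.≟ z)) row-step) (rest t) ⟩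
        does (t ℤP.≟ + suc n - + r) ∨ north (suc r) μ t        ≡⟨ sym (north-∷ r (suc n) μ t) ⟩
        north r (suc n ∷ μ) t                                  ∎
      where
        open ≡-Reasoning
        s : ℤ
        s = a + + (n ℕ.+ suc c)
        row-step : s ≡ + suc n - + r
        row-step = trans (identity a (+ n) (+ suc c)) (trans (cong (_+ + n) (Balanced.anchor b)) (identity′ (+ r) (+ n)))
          where identity : ∀ a n c → a + (n + c) ≡ (a + c) + n
                identity = solve-∀
                identity′ : ∀ r n → (+ 1 - r) + n ≡ (+ 1 + n) - r
                identity′ = solve-∀
        split : ∀ t → P t ≡ does (t ℤP.≟ s) ∨ remove s P t
        split t with t ℤP.≟ s
        ... | yes refl = top
        ... | no _     = sym (BoolP.∧-identityʳ (P t))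
        linked-∷ : ∀ {x xs} → All (ℕ._≤ x) xs → Linked ℕ._≥_ xs → Linked ℕ._≥_ (x ∷ xs)
        linked-∷ []          _      = [-]
        linked-∷ (y≤x ∷ _) sorted′ = y≤x ∷ sorted′

  -- Every balanced predicate is the north set of a partition: scan the
  -- window from its top, skipping points outside P and turning each point
  -- of P into a row (lexicographic recursion on n, then c).
  rebuild : ∀ n c r a (P : ℤ → Bool) → Balanced P a c r n → RowsFrom r n P
  rebuild zero c r a P b = [] , [] , [] , [] , no-rows b
  rebuild (suc n) c r a P b with P (a + + (n ℕ.+ c)) in top
  rebuild (suc n) c r a P b | false with rebuild n c r a P (drop-top b top)
  ... | μ , sorted , positive , bounded , north-set = μ , sorted , positive , All.map ℕP.m≤n⇒m≤1+n bounded , north-set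
  rebuild (suc n) zero    r a P b | true = ⊥-elim (no-top b top)
  rebuild (suc n) (suc c) r a P b | true =
    add-row b top (rebuild (suc n) c (suc r) a (remove (a + + (n ℕ.+ suc c)) P) (remove-top b top))

open Rebuilding

-- Existence and uniqueness of the shift k_i.
module Shift where

  open import Data.Integer using (_+_)

  bound : List ℕ → ℕ
  bound λs = suc (sum λs ℕ.+ length λs)

  rows<bound : ∀ λs → suc (length λs) ℕ.≤ bound λs
  rows<bound λs = s≤s (ℕP.m≤n+m (length λs) (sum λs))

  parts≤bound : ∀ λs → All (ℕ._≤ bound λs) λs
  parts≤bound λs =
    All.map (λ a≤sum → ℕP.m≤n⇒m≤1+n (ℕP.≤-trans a≤sum (ℕP.m≤m+n (sum λs) (length λs)))) (parts≤sum λs)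
    where
      parts≤sum : ∀ λs → All (ℕ._≤ sum λs) λs
      parts≤sum []       = []
      parts≤sum (a ∷ as) =
        ℕP.m≤m+n a (sum as) ∷ All.map (λ b≤ → ℕP.≤-trans b≤ (ℕP.m≤n+m (sum as) a)) (parts≤sum as)

  N-mod-1 : ∀ λs j → N 1 λs j ≡ length (cells λs)
  N-mod-1 λs j = all-kept (cells λs)
    where
      all-kept : ∀ xs → length (filterᵇ (congMod 1 j) xs) ≡ length xs
      all-kept []             = refl
      all-kept ((r , c) ∷ xs) rewrite dec-true (1 ∣? ∣ (+ c - + r) - + j ∣) (1∣ _) =
        cong suc (all-kept xs)

  -- A window [-L, L) with L beyond the bound contains exactly L north steps
  -- of a partition: the case m = 1, k = 0 of north-balance, where both
  -- classes contain all cells.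
  north-window : ∀ μ → IsPartition μ → ∀ L → bound μ ℕ.< L →
    count (λ u → north 1 μ (- + L + + u)) (L ℕ.+ L) ≡ L
  north-window μ (sorted , _) L μ<L = ℤP.+-injective (begin
      + count (λ u → north 1 μ (- + L + + u)) (L ℕ.+ L)
    ≡⟨ cong +_ (count-cong (L ℕ.+ L) (λ u _ → cong (north 1 μ) (sample-id (- + L + + u)))) ⟩
      + W.readsNorth 1 μ
    ≡⟨ sym (ℤP.+-identityʳ _) ⟩
      + W.readsNorth 1 μ + + 0
    ≡⟨ W.north-balance μ sorted (parts≤bound μ) (rows<bound μ) ⟩
      + L + (+ N 1 μ 0 - + N 1 μ 1)
    ≡⟨ cong₂ (λ x y → + L + (+ x - + y)) (N-mod-1 μ 0) (N-mod-1 μ 1) ⟩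
      + L + (+ length (cells μ) - + length (cells μ))
    ≡⟨ identity (+ L) (+ length (cells μ)) ⟩
      + L
    ∎)
    where
      open ≡-Reasoning
      module W = Window 0 0 (s≤s z≤n) (+ 0) (bound μ) L
                   (subst (ℕ._< L) (sym (trans (ℕP.+-identityʳ (bound μ ℕ.+ 0)) (ℕP.+-identityʳ (bound μ)))) μ<L)
      sample-id : ∀ y → y ≡ + 1 * (y + + 0) + + 0
      sample-id = solve-∀
      identity : ∀ L n → L + (n - n) ≡ L
      identity = solve-∀

  module _ (m' i : ℕ) (i<m : i ℕ.< suc m') (λs : List ℕ) (λ-partition : IsPartition λs) where

    m : ℕ
    m = suc m'

    k₀ : ℤ
    k₀ = + N m λs i - + N m λs (suc i)

    size : ℤ → ℕ
    size k = suc (bound λs ℕ.+ i ℕ.+ ∣ k ∣)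

    sorted : Linked ℕ._≥_ λs
    sorted = proj₁ λ-partition

    -- For k = k₀ the sampled north steps are balanced in the window, hence
    -- form the north set of a partition.
    shift-exists : IsEdgeSeq (subSeq m i k₀ (edgeSeq λs))
    shift-exists =
      let μ , μ-sorted , μ-positive , _ , north-set = rebuild L L 1 (- + L) (north 1 λs ∘ W.sample) balanced
      in  μ , (μ-sorted , μ-positive) , λ j →
            trans (edgeSeq-north λs (W.sample j)) (trans (cong not (north-set j)) (sym (edgeSeq-north μ j)))
      where
        L : ℕ
        L = size k₀
        module W = Window m' i i<m k₀ (bound λs) L ℕP.≤-refl
        beyond : ∀ u → L ℕ.+ L ℕ.≤ u → + L ℤ.≤ - + L + + u
        beyond u 2L≤u with ℕP.m≤n⇒∃[o]m+o≡n 2L≤u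
        ... | d , refl = gap-≤ d (identity (+ L) (+ d))
          where identity : ∀ L d → - L + ((L + L) + d) ≡ L + d
                identity = solve-∀
        balanced : Balanced (north 1 λs ∘ W.sample) (- + L) L 1 L
        balanced = record
          { anchor   = identity (+ L)
          ; left     = W.north-left λs (rows<bound λs)
          ; right    = λ u 2L≤u → W.north-right λs (parts≤bound λs) (- + L + + u) (beyond u 2L≤u)
          ; balanced = ℤP.+-injective (+-cancelʳ k₀ (W.north-balance λs sorted (parts≤bound λs) (rows<bound λs)))
          }
          where identity : ∀ L → - L + L ≡ + 1 - + 1
                identity = solve-∀

    -- If the shift k also yields an edge sequence, of a partition μ, the
    -- window reads exactly L north steps (those of μ), which forces k = k₀.
    shift-unique : ∀ k → IsEdgeSeq (subSeq m i k (edgeSeq λs)) → k ≡ k₀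
    shift-unique k (μ , μ-partition , same) =
      +-cancelˡ (+ L) (trans (sym (cong (λ p → + p + k) reads-μ))
                             (W.north-balance λs sorted (parts≤bound λs) (rows<bound λs)))
      where
        L : ℕ
        L = size k ℕ.+ bound μ
        module W = Window m' i i<m k (bound λs) L (ℕP.m≤m+n (size k) (bound μ))
        reads-μ : W.readsNorth 1 λs ≡ L
        reads-μ = trans (count-cong (L ℕ.+ L) (λ u _ → BoolP.not-injective
                          (trans (sym (edgeSeq-north λs _)) (trans (same (W.pos u)) (edgeSeq-north μ (W.pos u))))))
                        (north-window μ μ-partition L (s≤s (ℕP.m≤n+m (bound μ) (bound λs ℕ.+ i ℕ.+ ∣ k ∣))))


open Shift

open import Data.Nat using (_≤_; _<_)

-- Proposition 5.2: the m-shift of λ is (N₀ - N₁, …, N_{m-1} - N_m) with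
-- N_m = N₀; the statement holds for every m ≥ 1.
proposition5p2 : (m : ℕ) → 2 ≤ m → (λs : List ℕ) → IsPartition λs →
    (i : ℕ) → i < m →
    IsShiftComponent m λs i (+ N m λs i - + N m λs (suc i))
proposition5p2 (suc m') _ λs λ-partition i i<m =
  shift-exists m' i i<m λs λ-partition , shift-unique m' i i<m λs λ-partition
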